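{- For any formulas $A,B$: $A\le B$ is derivable in algebraic $\mathbf{LG}$ if and only if $B^\bot\le A^\bot$ is derivable.
   Context: Notation: $\otimes$ tensor, $\oplus$ par, $/,\backslash$ right/left implications, $\oslash$ right coimplication, $\ominus$ left coimplication (circled slash / circled backslash in the source). Formulas $A,B ::= p\mid\bar p\mid A\otimes B\mid B\oplus A\mid A/B\mid B\ominus A\mid B\backslash A\mid A\oslash B\mid A\land B\mid A\lor B$, with linear negation $p^\bot=\bar p$, $\bar p^\bot=p$, $(A\otimes B)^\bot=B^\bot\oplus A^\bot$, $(A\oplus B)^\bot=B^\bot\otimes A^\bot$, $(A/B)^\bot=B^\bot\ominus A^\bot$, $(B\ominus A)^\bot=A^\bot/B^\bot$, $(B\backslash A)^\bot=A^\bot\oslash B^\bot$, $(A\oslash B)^\bot=B^\bot\backslash A^\bot$, $(A\land B)^\bot=B^\bot\lor A^\bot$, $(A\lor B)^\bot=B^\bot\land A^\bot$ (an involution). Algebraic $\mathbf{LG}_\emptyset$: reflexivity $A\le A$; transitivity; residuation $A\otimes B\le C$ iff $A\le C/B$ iff $B\le A\backslash C$; coresiduation $C\le A\oplus B$ iff $A\ominus C\le B$ iff $C\oslash B\le A$; $A\le B\land C$ iff ($A\le B$ and $A\le C$); $A\lor B\le C$ iff ($A\le C$ and $B\le C$). $\mathbf{LG}_I$ adds: from $A\oslash B\le C\backslash D$ infer $C\otimes A\le D\oplus B$; from $A\ominus B\le C/D$ infer $B\otimes D\le A\oplus C$; from $A\ominus B\le C\backslash D$ infer $C\otimes B\le A\oplus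 D$; from $A\oslash B\le C/D$ infer $A\otimes D\le C\oplus B$. -}

module Defs where

data Formula (At : Set) : Set where
  atom  : At → Formula At
  natom : At → Formula At
  _⊗_   : Formula At → Formula At → Formula At
  _⊕_   : Formula At → Formula At → Formula At
  _/_   : Formula At → Formula At → Formula At
  _⊖_   : Formula At → Formula At → Formula At
  _\\_  : Formula At → Formula At → Formula At
  _⊘_   : Formula At → Formula At → Formula At
  _∧_   : Formula At → Formula At → Formula At
  _∨_   : Formula At → Formula At → Formula At

infixl 30 _⊗_ _⊕_ _/_ _⊖_ _\\_ _⊘_ _∧_ _∨_

_⊥ : ∀ {At} → Formula At → Formula At
atom p ⊥  = natom p
natom p ⊥ = atom p
(A ⊗ B) ⊥ = (B ⊥) ⊕ (A ⊥)
(A ⊕ B) ⊥ = (B ⊥) ⊗ (A ⊥)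
(A / B) ⊥ = (B ⊥) ⊖ (A ⊥)
(B ⊖ A) ⊥ = (A ⊥) / (B ⊥)
(B \\ A) ⊥ = (A ⊥) ⊘ (B ⊥)
(A ⊘ B) ⊥ = (B ⊥) \\ (A ⊥)
(A ∧ B) ⊥ = (B ⊥) ∨ (A ⊥)
(A ∨ B) ⊥ = (B ⊥) ∧ (A ⊥)

data Variant : Set where
  LG∅ LGI : Variant

-- Derivability of A ≤ B in algebraic LG_v.  "iff" rules are given in both directions.
data _⊢_≤_ {At : Set} : Variant → Formula At → Formula At → Set where
  refl  : ∀ {v A} → v ⊢ A ≤ A
  trans : ∀ {v A B C} → v ⊢ A ≤ B → v ⊢ B ≤ C → v ⊢ A ≤ C
  r⊗/   : ∀ {v A B C} → v ⊢ A ⊗ B ≤ C → v ⊢ A ≤ C / B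
  r/⊗   : ∀ {v A B C} → v ⊢ A ≤ C / B → v ⊢ A ⊗ B ≤ C
  r⊗\\  : ∀ {v A B C} → v ⊢ A ⊗ B ≤ C → v ⊢ B ≤ A \\ C
  r\\⊗  : ∀ {v A B C} → v ⊢ B ≤ A \\ C → v ⊢ A ⊗ B ≤ C
  c⊕⊖   : ∀ {v A B C} → v ⊢ C ≤ A ⊕ B → v ⊢ A ⊖ C ≤ B
  c⊖⊕   : ∀ {v A B C} → v ⊢ A ⊖ C ≤ B → v ⊢ C ≤ A ⊕ B
  c⊕⊘   : ∀ {v A B C} → v ⊢ C ≤ A ⊕ B → v ⊢ C ⊘ B ≤ A
  c⊘⊕   : ∀ {v A B C} → v ⊢ C ⊘ B ≤ A → v ⊢ C ≤ A ⊕ B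
  ∧I    : ∀ {v A B C} → v ⊢ A ≤ B → v ⊢ A ≤ C → v ⊢ A ≤ B ∧ C
  ∧E₁   : ∀ {v A B C} → v ⊢ A ≤ B ∧ C → v ⊢ A ≤ B
  ∧E₂   : ∀ {v A B C} → v ⊢ A ≤ B ∧ C → v ⊢ A ≤ C
  ∨I    : ∀ {v A B C} → v ⊢ A ≤ C → v ⊢ B ≤ C → v ⊢ A ∨ B ≤ C
  ∨E₁   : ∀ {v A B C} → v ⊢ A ∨ B ≤ C → v ⊢ A ≤ C
  ∨E₂   : ∀ {v A B C} → v ⊢ A ∨ B ≤ C → v ⊢ B ≤ C
  i1 : ∀ {A B C D} → LGI ⊢ A ⊘ B ≤ C \\ D → LGI ⊢ C ⊗ A ≤ D ⊕ B
  i2 : ∀ {A B C D} → LGI ⊢ A ⊖ B ≤ C / D → LGI ⊢ B ⊗ D ≤ A ⊕ C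
  i3 : ∀ {A B C D} → LGI ⊢ A ⊖ B ≤ C \\ D → LGI ⊢ C ⊗ B ≤ A ⊕ D
  i4 : ∀ {A B C D} → LGI ⊢ A ⊘ B ≤ C / D → LGI ⊢ A ⊗ D ≤ C ⊕ B

-- Negation is an involutive order-reversing symmetry of the rule set: it
-- exchanges residuation with coresiduation, ∧ with ∨, and the interaction
-- rules among themselves. So every derivation of A ≤ B dualises rule by rule
-- to one of B⊥ ≤ A⊥, and applying this twice and using A⊥⊥ = A gives the
-- converse.
module Submission where

open import Defs
open import Function.Bundles using (_⇔_; mk⇔)
open import Relation.Binary.PropositionalEquality using (_≡_; refl; cong₂; subst₂)

⊥-involutive : ∀ {At} (A : Formula At) → (A ⊥) ⊥ ≡ A
⊥-involutive (atom p)  = refl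
⊥-involutive (natom p) = refl
⊥-involutive (A ⊗ B)   = cong₂ _⊗_ (⊥-involutive A) (⊥-involutive B)
⊥-involutive (A ⊕ B)   = cong₂ _⊕_ (⊥-involutive A) (⊥-involutive B)
⊥-involutive (A / B)   = cong₂ _/_ (⊥-involutive A) (⊥-involutive B)
⊥-involutive (A ⊖ B)   = cong₂ _⊖_ (⊥-involutive A) (⊥-involutive B)
⊥-involutive (A \\ B)  = cong₂ _\\_ (⊥-involutive A) (⊥-involutive B)
⊥-involutive (A ⊘ B)   = cong₂ _⊘_ (⊥-involutive A) (⊥-involutive B)
⊥-involutive (A ∧ B)   = cong₂ _∧_ (⊥-involutive A) (⊥-involutive B)
⊥-involutive (A ∨ B)   = cong₂ _∨_ (⊥-involutive A) (⊥-involutive B)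

⊢-dual : ∀ {At v} {A B : Formula At} → v ⊢ A ≤ B → v ⊢ (B ⊥) ≤ (A ⊥)
⊢-dual refl        = refl
⊢-dual (trans d e) = trans (⊢-dual e) (⊢-dual d)
⊢-dual (r⊗/ d)     = c⊕⊖ (⊢-dual d)
⊢-dual (r/⊗ d)     = c⊖⊕ (⊢-dual d)
⊢-dual (r⊗\\ d)    = c⊕⊘ (⊢-dual d)
⊢-dual (r\\⊗ d)    = c⊘⊕ (⊢-dual d)
⊢-dual (c⊕⊖ d)     = r⊗/ (⊢-dual d)
⊢-dual (c⊖⊕ d)     = r/⊗ (⊢-dual d)
⊢-dual (c⊕⊘ d)     = r⊗\\ (⊢-dual d)
⊢-dual (c⊘⊕ d)     = r\\⊗ (⊢-dual d)
⊢-dual (∧I d e)    = ∨I (⊢-dual e) (⊢-dual d)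
⊢-dual (∧E₁ d)     = ∨E₂ (⊢-dual d)
⊢-dual (∧E₂ d)     = ∨E₁ (⊢-dual d)
⊢-dual (∨I d e)    = ∧I (⊢-dual e) (⊢-dual d)
⊢-dual (∨E₁ d)     = ∧E₂ (⊢-dual d)
⊢-dual (∨E₂ d)     = ∧E₁ (⊢-dual d)
⊢-dual (i1 d)      = i1 (⊢-dual d)
⊢-dual (i2 d)      = i2 (⊢-dual d)
⊢-dual (i3 d)      = i4 (⊢-dual d)
⊢-dual (i4 d)      = i3 (⊢-dual d)

⊢-undual : ∀ {At v} {A B : Formula At} → v ⊢ (B ⊥) ≤ (A ⊥) → v ⊢ A ≤ B
⊢-undual {v = v} {A} {B} d =
  subst₂ (v ⊢_≤_) (⊥-involutive A) (⊥-involutive B) (⊢-dual d)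

lemma5 : (At : Set) (v : Variant) (A B : Formula At) →
         (v ⊢ A ≤ B) ⇔ (v ⊢ (B ⊥) ≤ (A ⊥))
lemma5 At v A B = mk⇔ ⊢-dual ⊢-undual
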